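{- Let $\mathcal{P}\in\mathbb{F}_2[q]$ be a polynomial with constant term $1$, $\mathcal{P}\notin\{1,\,1+q,\,1+q+q^2\}$, and let $\mathcal{P}^\ast$ be defined by $\mathcal{P}\mathcal{P}^\ast=1+q^{\operatorname{ord}(\mathcal{P})}$. If $\mathcal{P}^\ast$ is primitive, then the set of $n\ge0$ for which the coefficient of $q^n$ in $1/\mathcal{P}\in\mathbb{F}_2[[q]]$ equals $1$ has density at most $1/2$.
   Context: $\operatorname{ord}(\mathcal{Q})$ is the least positive integer $D$ such that $\mathcal{Q}$ divides $1+q^D$ in $\mathbb{F}_2[q]$. A polynomial $\mathcal{Q}$ of degree $d$ is primitive if $\operatorname{ord}(\mathcal{Q})=2^d-1$. The density of $B\subseteq\mathbb{N}$ is $\lim_{n\to\infty}|B\cap[0,n]|/(n+1)$. -}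

module Defs where

open import Data.Bool using (Bool; true; false; _∧_; _xor_; if_then_else_)
open import Data.Nat using (ℕ; zero; suc; _+_; _∸_; _^_; _<_; _≤_)
open import Data.List using (List; []; _∷_; length; replicate; _++_)
open import Data.Product using (Σ; _×_; ∃)
open import Relation.Binary.PropositionalEquality using (_≡_)
open import Relation.Nullary using (¬_)
open import Data.Integer using (+_)
import Data.Rational as ℚ
open ℚ using (ℚ; _/_; ∣_∣; _-_)

-- Polynomials over F₂ : coefficient lists, lowest degree first
-- (true = 1, false = 0).  Trailing zeros are allowed; equality of
-- polynomials is the semantic one, via coefficients.
Poly : Set
Poly = List Bool

coeff : Poly → ℕ → Bool
coeff []       n       = false
coeff (b ∷ bs) zero    = b
coeff (b ∷ bs) (suc n) = coeff bs n

_≈ₚ_ : Poly → Poly → Set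
p ≈ₚ r = ∀ n → coeff p n ≡ coeff r n

_+ₚ_ : Poly → Poly → Poly
[]       +ₚ r        = r
(a ∷ p)  +ₚ []       = a ∷ p
(a ∷ p)  +ₚ (b ∷ r)  = (a xor b) ∷ (p +ₚ r)

_*ₚ_ : Poly → Poly → Poly
[]      *ₚ r = []
(a ∷ p) *ₚ r = (if a then r else []) +ₚ (false ∷ (p *ₚ r))

oneₚ : Poly
oneₚ = true ∷ []

onePlusQPow : ℕ → Poly
onePlusQPow D = oneₚ +ₚ (replicate D false ++ (true ∷ []))

_∣ₚ_ : Poly → Poly → Set
Q ∣ₚ R = ∃ λ S → (Q *ₚ S) ≈ₚ R

strip : Poly → Poly
strip []       = []
strip (b ∷ bs) = cons' b (strip bs)
  where
  cons' : Bool → Poly → Poly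
  cons' false [] = []
  cons' c     xs = c ∷ xs

-- degree (the zero polynomial gets degree 0; irrelevant here)
deg : Poly → ℕ
deg p = length (strip p) ∸ 1

IsOrd : Poly → ℕ → Set
IsOrd Q D = (0 < D) × (Q ∣ₚ onePlusQPow D)
          × (∀ D′ → 0 < D′ → D′ < D → ¬ (Q ∣ₚ onePlusQPow D′))

Primitive : Poly → Set
Primitive Q = IsOrd Q (2 ^ deg Q ∸ 1)

conv : Poly → (ℕ → Bool) → ℕ → Bool
conv []      s n       = false
conv (a ∷ p) s zero    = a ∧ s zero
conv (a ∷ p) s (suc n) = (a ∧ s (suc n)) xor conv p (λ k → s k) n

IsInverse : Poly → (ℕ → Bool) → Set
IsInverse p s = ∀ n → conv p s n ≡ coeff oneₚ n

count : (ℕ → Bool) → ℕ → ℕ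
count s zero    = if s zero then 1 else 0
count s (suc n) = count s n + (if s (suc n) then 1 else 0)

HasDensityAtMost : (ℕ → Bool) → ℚ → Set
HasDensityAtMost s r =
  Σ ℚ λ d → (d ℚ.≤ r) ×
    (∀ (ε : ℚ) → ℚ.0ℚ ℚ.< ε → ∃ λ N → ∀ n → N ≤ n →
       ∣ ((+ count s n) / suc n) - d ∣ ℚ.≤ ε)

{-# OPTIONS --safe #-}
module Submission where

-- Since P P* = 1 + q^D with D = ord P, the inverse s = 1/P equals P*/(1 + q^D): it is
-- D-periodic and agrees with P* on [0, D), because deg P* = D - deg P < D. Hence s has density
-- w/D, where w is the number of nonzero coefficients of P*, and it remains to show 2w ≤ D.
-- With b = deg P* we have w ≤ b + 1, while primitivity gives 2^b - 1 = ord P* ≤ D; this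
-- suffices for b ≥ 4. For b ≤ 3 primitivity rules out b = 0 and pins P* down to 1 + q,
-- 1 + q + q² or a cubic with w ≤ 3; the few values of D that are then too small either
-- force P = 1 + q + q² or are impossible.

open import Defs
open import Algebra.Bundles using (CommutativeRing)
open import Data.Bool using (Bool; true; false; _∧_; _xor_; if_then_else_)
open import Data.Bool.Properties
  using (xor-∧-commutativeRing; xor-comm; xor-assoc; xor-identityʳ; ∧-comm; ∧-zeroʳ; ∧-distribʳ-xor)
open import Algebra.Properties.CommutativeSemigroup
  (CommutativeRing.+-commutativeSemigroup xor-∧-commutativeRing) using (interchange)
open import Data.Empty using (⊥; ⊥-elim)
open import Data.Integer as ℤ using (_⊖_)
import Data.Integer.Properties as ℤP
open import Data.List using ([]; _∷_; length; replicate; _++_; applyUpTo)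
open import Data.Nat using (ℕ; zero; suc; _+_; _*_; _∸_; _^_; _⊔_; _≤_; _<_; z≤n; s≤s; NonZero)
import Data.Nat as ℕ
import Data.Nat.DivMod as ℕ
import Data.Nat.Properties as ℕ
open import Data.Nat.Coprimality using (Coprime)
open import Data.Nat.Tactic.RingSolver using (solve-∀)
open import Data.Product using (Σ; _,_)
open import Data.Rational as ℚ using (mkℚ; toℚᵘ; fromℚᵘ; ½; _/_; _-_; ∣_∣)
import Data.Rational.Properties as ℚP
open import Data.Rational.Unnormalised as ℚᵘ using (mkℚᵘ; *≤*)
import Data.Rational.Unnormalised.Properties as ℚᵘP
open import Data.Sum using (inj₁; inj₂)
open import Function using (_∘_; case_of_)
open import Relation.Binary.PropositionalEquality
open import Relation.Nullary using (¬_)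

-- Products of polynomials and power series over F₂

infixl 7 _⊛_

_⊛_ : (ℕ → Bool) → (ℕ → Bool) → ℕ → Bool
(f ⊛ g) zero    = f 0 ∧ g 0
(f ⊛ g) (suc n) = (f 0 ∧ g (suc n)) xor ((f ∘ suc) ⊛ g) n

⊛-zeroˡ : ∀ g → (λ _ → false) ⊛ g ≗ (λ _ → false)
⊛-zeroˡ g zero    = refl
⊛-zeroˡ g (suc n) = ⊛-zeroˡ g n

⊛-cong : ∀ {f f′ g g′} → f ≗ f′ → g ≗ g′ → f ⊛ g ≗ f′ ⊛ g′
⊛-cong f≗f′ g≗g′ zero    = cong₂ _∧_ (f≗f′ 0) (g≗g′ 0)
⊛-cong f≗f′ g≗g′ (suc n) = cong₂ _xor_ (cong₂ _∧_ (f≗f′ 0) (g≗g′ (suc n))) (⊛-cong (f≗f′ ∘ suc) g≗g′ n)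

⊛-resp-≗ : ∀ {f f′ g g′ h} → f ≗ f′ → g ≗ g′ → f ⊛ g ≗ h → f′ ⊛ g′ ≗ h
⊛-resp-≗ f≗f′ g≗g′ fg≗h n = trans (sym (⊛-cong f≗f′ g≗g′ n)) (fg≗h n)

⊛-sucʳ : ∀ f g n → (f ⊛ g) (suc n) ≡ (f ⊛ (g ∘ suc)) n xor (f (suc n) ∧ g 0)
⊛-sucʳ f g zero    = refl
⊛-sucʳ f g (suc n) = begin
  (f 0 ∧ g (suc (suc n))) xor ((f ∘ suc) ⊛ g) (suc n)
    ≡⟨ cong ((f 0 ∧ g (suc (suc n))) xor_) (⊛-sucʳ (f ∘ suc) g n) ⟩
  (f 0 ∧ g (suc (suc n))) xor (((f ∘ suc) ⊛ (g ∘ suc)) n xor (f (suc (suc n)) ∧ g 0))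
    ≡⟨ xor-assoc (f 0 ∧ g (suc (suc n))) _ _ ⟨
  (f ⊛ (g ∘ suc)) (suc n) xor (f (suc (suc n)) ∧ g 0)
    ∎
  where open ≡-Reasoning

⊛-comm : ∀ f g → f ⊛ g ≗ g ⊛ f
⊛-comm f g zero    = ∧-comm (f 0) (g 0)
⊛-comm f g (suc n) = begin
  (f 0 ∧ g (suc n)) xor ((f ∘ suc) ⊛ g) n   ≡⟨ cong₂ _xor_ (∧-comm (f 0) (g (suc n))) (⊛-comm (f ∘ suc) g n) ⟩
  (g (suc n) ∧ f 0) xor (g ⊛ (f ∘ suc)) n   ≡⟨ xor-comm (g (suc n) ∧ f 0) _ ⟩
  (g ⊛ (f ∘ suc)) n xor (g (suc n) ∧ f 0)   ≡⟨ ⊛-sucʳ g f n ⟨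
  (g ⊛ f) (suc n)                           ∎
  where open ≡-Reasoning

conv-⊛ : ∀ p s → conv p s ≗ coeff p ⊛ s
conv-⊛ []      s zero    = refl
conv-⊛ []      s (suc n) = sym (⊛-zeroˡ s n)
conv-⊛ (a ∷ p) s zero    = refl
conv-⊛ (a ∷ p) s (suc n) = cong ((a ∧ s (suc n)) xor_) (conv-⊛ p s n)

conv-congˡ : ∀ p p′ s → p ≈ₚ p′ → conv p s ≗ conv p′ s
conv-congˡ p p′ s p≈p′ n = trans (conv-⊛ p s n) (trans (⊛-cong p≈p′ (λ _ → refl) n) (sym (conv-⊛ p′ s n)))

conv-congʳ : ∀ p {s s′} → s ≗ s′ → conv p s ≗ conv p s′
conv-congʳ p {s} {s′} s≗s′ n = trans (conv-⊛ p s n) (trans (⊛-cong (λ _ → refl) s≗s′ n) (sym (conv-⊛ p s′ n)))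

coeff-+ₚ : ∀ p r n → coeff (p +ₚ r) n ≡ coeff p n xor coeff r n
coeff-+ₚ []      r       n       = refl
coeff-+ₚ (a ∷ p) []      n       = sym (xor-identityʳ _)
coeff-+ₚ (a ∷ p) (b ∷ r) zero    = refl
coeff-+ₚ (a ∷ p) (b ∷ r) (suc n) = coeff-+ₚ p r n

coeff-if : ∀ a r n → coeff (if a then r else []) n ≡ a ∧ coeff r n
coeff-if true  r n = refl
coeff-if false r n = refl

coeff-*ₚ : ∀ p r → coeff (p *ₚ r) ≗ coeff p ⊛ coeff r
coeff-*ₚ []      r n       = sym (⊛-zeroˡ (coeff r) n)
coeff-*ₚ (a ∷ p) r zero    =
  trans (coeff-+ₚ (if a then r else []) _ 0) (trans (xor-identityʳ _) (coeff-if a r 0))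
coeff-*ₚ (a ∷ p) r (suc n) =
  trans (coeff-+ₚ (if a then r else []) _ (suc n)) (cong₂ _xor_ (coeff-if a r (suc n)) (coeff-*ₚ p r n))

*ₚ-comm : ∀ p r → (p *ₚ r) ≈ₚ (r *ₚ p)
*ₚ-comm p r n = trans (coeff-*ₚ p r n) (trans (⊛-comm (coeff p) (coeff r) n) (sym (coeff-*ₚ r p n)))

*ₚ-congˡ : ∀ p p′ r → p ≈ₚ p′ → (p *ₚ r) ≈ₚ (p′ *ₚ r)
*ₚ-congˡ p p′ r p≈p′ n =
  trans (coeff-*ₚ p r n) (trans (⊛-cong p≈p′ (λ _ → refl) n) (sym (coeff-*ₚ p′ r n)))

conv-+ₚ : ∀ p r s n → conv (p +ₚ r) s n ≡ conv p s n xor conv r s n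
conv-+ₚ []      r       s n       = refl
conv-+ₚ (a ∷ p) []      s n       = sym (xor-identityʳ _)
conv-+ₚ (a ∷ p) (b ∷ r) s zero    = ∧-distribʳ-xor (s 0) a b
conv-+ₚ (a ∷ p) (b ∷ r) s (suc n) = begin
  ((a xor b) ∧ s (suc n)) xor conv (p +ₚ r) s n
    ≡⟨ cong₂ _xor_ (∧-distribʳ-xor (s (suc n)) a b) (conv-+ₚ p r s n) ⟩
  ((a ∧ s (suc n)) xor (b ∧ s (suc n))) xor (conv p s n xor conv r s n)
    ≡⟨ interchange (a ∧ s (suc n)) (b ∧ s (suc n)) (conv p s n) (conv r s n) ⟩
  ((a ∧ s (suc n)) xor conv p s n) xor ((b ∧ s (suc n)) xor conv r s n)
    ∎
  where open ≡-Reasoning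

conv-if : ∀ a r s n → conv (if a then r else []) s n ≡ a ∧ conv r s n
conv-if true  r s n       = refl
conv-if false r s zero    = refl
conv-if false r s (suc n) = refl

conv-*ₚ : ∀ p r s → conv (p *ₚ r) s ≗ conv p (conv r s)
conv-*ₚ []      r s zero    = refl
conv-*ₚ []      r s (suc n) = refl
conv-*ₚ (a ∷ p) r s zero    =
  trans (conv-+ₚ (if a then r else []) _ s 0) (trans (xor-identityʳ _) (conv-if a r s 0))
conv-*ₚ (a ∷ p) r s (suc n) =
  trans (conv-+ₚ (if a then r else []) _ s (suc n)) (cong₂ _xor_ (conv-if a r s (suc n)) (conv-*ₚ p r s n))

conv-oneₚ : ∀ s → conv oneₚ s ≗ s
conv-oneₚ s zero    = refl
conv-oneₚ s (suc n) = xor-identityʳ _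

conv-coeff-oneₚ : ∀ p → conv p (coeff oneₚ) ≗ coeff p
conv-coeff-oneₚ p n = begin
  conv p (coeff oneₚ) n      ≡⟨ conv-⊛ p _ n ⟩
  (coeff p ⊛ coeff oneₚ) n   ≡⟨ ⊛-comm (coeff p) _ n ⟩
  (coeff oneₚ ⊛ coeff p) n   ≡⟨ conv-⊛ oneₚ _ n ⟨
  conv oneₚ (coeff p) n      ≡⟨ conv-oneₚ (coeff p) n ⟩
  coeff p n                  ∎
  where open ≡-Reasoning

-- Degrees

record HasDegree (f : ℕ → Bool) (d : ℕ) : Set where
  field
    leading   : f d ≡ true
    vanishing : ∀ {i} → d < i → f i ≡ false
open HasDegree

hasDegree-suc : ∀ {f d} → HasDegree f (suc d) → HasDegree (f ∘ suc) d
hasDegree-suc f↑ = record { leading = leading f↑ ; vanishing = vanishing f↑ ∘ s≤s }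

hasDegree-∷ : ∀ {b p d} → HasDegree (coeff p) d → HasDegree (coeff (b ∷ p)) (suc d)
hasDegree-∷ p↑ = record { leading = leading p↑ ; vanishing = λ { (s≤s d<i) → vanishing p↑ d<i } }

hasDegree-cong : ∀ {f g d} → f ≗ g → HasDegree f d → HasDegree g d
hasDegree-cong f≗g f↑ = record
  { leading   = trans (sym (f≗g _)) (leading f↑)
  ; vanishing = λ d<i → trans (sym (f≗g _)) (vanishing f↑ d<i)
  }

hasDegree-unique : ∀ {f a b} → HasDegree f a → HasDegree f b → a ≡ b
hasDegree-unique f↑a f↑b = ℕ.≤-antisym (ℕ.≮⇒≥ (below-leading f↑a f↑b)) (ℕ.≮⇒≥ (below-leading f↑b f↑a))
  where
  below-leading : ∀ {f a b} → HasDegree f a → HasDegree f b → ¬ b < a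
  below-leading f↑a f↑b b<a = case trans (sym (leading f↑a)) (vanishing f↑b b<a) of λ ()

⊛-constantˡ : ∀ {f} g → (∀ i → f (suc i) ≡ false) → ∀ n → (f ⊛ g) n ≡ f 0 ∧ g n
⊛-constantˡ     g f-constant zero    = refl
⊛-constantˡ {f} g f-constant (suc n) = begin
  (f 0 ∧ g (suc n)) xor ((f ∘ suc) ⊛ g) n       ≡⟨ cong ((f 0 ∧ g (suc n)) xor_) (⊛-cong f-constant (λ _ → refl) n) ⟩
  (f 0 ∧ g (suc n)) xor ((λ _ → false) ⊛ g) n   ≡⟨ cong ((f 0 ∧ g (suc n)) xor_) (⊛-zeroˡ g n) ⟩
  (f 0 ∧ g (suc n)) xor false                   ≡⟨ xor-identityʳ _ ⟩
  f 0 ∧ g (suc n)                               ∎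
  where open ≡-Reasoning

⊛-sucˡ : ∀ {f g b} → HasDegree g b → ∀ {n} → b ≤ n → (f ⊛ g) (suc n) ≡ ((f ∘ suc) ⊛ g) n
⊛-sucˡ {f} {g} g↑ {n} b≤n =
  cong (_xor ((f ∘ suc) ⊛ g) n) (trans (cong (f 0 ∧_) (vanishing g↑ (s≤s b≤n))) (∧-zeroʳ (f 0)))

⊛-hasDegree : ∀ {f g} a {b} → HasDegree f a → HasDegree g b → HasDegree (f ⊛ g) (a + b)
⊛-hasDegree {f} {g} zero f↑ g↑ = record
  { leading   = trans (⊛-constantˡ g f-constant _) (cong₂ _∧_ (leading f↑) (leading g↑))
  ; vanishing = λ b<i → trans (⊛-constantˡ g f-constant _)
                              (trans (cong (f 0 ∧_) (vanishing g↑ b<i)) (∧-zeroʳ (f 0)))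
  }
  where
  f-constant : ∀ i → f (suc i) ≡ false
  f-constant i = vanishing f↑ (s≤s z≤n)
⊛-hasDegree {f} {g} (suc a) {b} f↑ g↑ = record
  { leading   = trans (⊛-sucˡ {f} g↑ (ℕ.m≤n+m b a)) (leading tail↑)
  ; vanishing = λ { {suc i} (s≤s a+b<i) →
      trans (⊛-sucˡ {f} g↑ (ℕ.≤-trans (ℕ.m≤n+m b a) (ℕ.<⇒≤ a+b<i))) (vanishing tail↑ a+b<i) }
  }
  where
  tail↑ : HasDegree ((f ∘ suc) ⊛ g) (a + b)
  tail↑ = ⊛-hasDegree a (hasDegree-suc f↑) g↑

coeff-beyond-strip : ∀ p {i} → length (strip p) ≤ i → coeff p i ≡ false
coeff-beyond-strip []       _ = refl
coeff-beyond-strip (b ∷ bs) {i} with strip bs | coeff-beyond-strip bs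
coeff-beyond-strip (false ∷ bs) {zero}  | []    | _  = λ _ → refl
coeff-beyond-strip (false ∷ bs) {suc i} | []    | ih = λ _ → ih z≤n
coeff-beyond-strip (true  ∷ bs) {suc i} | []    | ih = λ _ → ih z≤n
coeff-beyond-strip (false ∷ bs) {suc i} | _ ∷ _ | ih = λ { (s≤s h) → ih h }
coeff-beyond-strip (true  ∷ bs) {suc i} | _ ∷ _ | ih = λ { (s≤s h) → ih h }

coeff-last-strip : ∀ p {m} → length (strip p) ≡ suc m → coeff p m ≡ true
coeff-last-strip []       ()
coeff-last-strip (b ∷ bs) {m} with strip bs | coeff-last-strip bs
coeff-last-strip (true  ∷ bs) {zero}  | []    | _  = λ _ → refl
coeff-last-strip (false ∷ bs) {suc m} | _ ∷ _ | ih = ih ∘ ℕ.suc-injective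
coeff-last-strip (true  ∷ bs) {suc m} | _ ∷ _ | ih = ih ∘ ℕ.suc-injective

deg-hasDegree : ∀ p {n} → coeff p n ≡ true → HasDegree (coeff p) (deg p)
deg-hasDegree p {n} pₙ with length (strip p) in len
... | zero  = case trans (sym pₙ) (coeff-beyond-strip p (subst (_≤ n) (sym len) z≤n)) of λ ()
... | suc m = record
  { leading   = coeff-last-strip p len
  ; vanishing = λ m<i → coeff-beyond-strip p (subst (_≤ _) (sym len) m<i)
  }

coeff-applyUpTo-++ : ∀ {f} d → HasDegree f d → coeff (applyUpTo f d ++ (true ∷ [])) ≗ f
coeff-applyUpTo-++ zero    f↑ zero    = sym (leading f↑)
coeff-applyUpTo-++ zero    f↑ (suc i) = sym (vanishing f↑ (s≤s z≤n))
coeff-applyUpTo-++ (suc d) f↑ zero    = refl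
coeff-applyUpTo-++ (suc d) f↑ (suc i) = coeff-applyUpTo-++ d (hasDegree-suc f↑) i

≈ₚ-explicit : ∀ p d → coeff p 0 ≡ true → HasDegree (coeff p) (suc d) →
  p ≈ₚ (true ∷ applyUpTo (coeff p ∘ suc) d ++ (true ∷ []))
≈ₚ-explicit p d p₀ p↑ zero    = p₀
≈ₚ-explicit p d p₀ p↑ (suc i) = sym (coeff-applyUpTo-++ d (hasDegree-suc p↑) i)

2≤degree : ∀ P {a} → coeff P 0 ≡ true → HasDegree (coeff P) a →
  ¬ (P ≈ₚ (true ∷ [])) → ¬ (P ≈ₚ (true ∷ true ∷ [])) → 2 ≤ a
2≤degree P {zero}        P₀ P↑ P≉1 _   = ⊥-elim (P≉1 λ { zero → P₀ ; (suc i) → vanishing P↑ (s≤s z≤n) })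
2≤degree P {suc zero}    P₀ P↑ _ P≉1+q = ⊥-elim (P≉1+q (≈ₚ-explicit P 0 P₀ P↑))
2≤degree P {suc (suc a)} _  _  _ _     = s≤s (s≤s z≤n)

-- Periodicity of 1/P

qPow : ℕ → Poly
qPow D = replicate D false ++ (true ∷ [])

qPow-hasDegree : ∀ D → HasDegree (coeff (qPow D)) D
qPow-hasDegree zero    = record { leading = refl ; vanishing = λ { {suc i} _ → refl } }
qPow-hasDegree (suc D) = hasDegree-∷ (qPow-hasDegree D)

onePlusQPow-hasDegree : ∀ D → 0 < D → HasDegree (coeff (onePlusQPow D)) D
onePlusQPow-hasDegree (suc D) _ = hasDegree-∷ (qPow-hasDegree D)

conv-qPow-< : ∀ D s {n} → n < D → conv (qPow D) s n ≡ false
conv-qPow-< (suc D) s {zero}  _         = refl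
conv-qPow-< (suc D) s {suc n} (s≤s n<D) = conv-qPow-< D s n<D

conv-qPow-+ : ∀ D s n → conv (qPow D) s (n + D) ≡ s n
conv-qPow-+ zero    s n = trans (cong (conv oneₚ s) (ℕ.+-identityʳ n)) (conv-oneₚ s n)
conv-qPow-+ (suc D) s n = trans (cong (conv (qPow (suc D)) s) (ℕ.+-suc n D)) (conv-qPow-+ D s n)

Periodic : (ℕ → Bool) → ℕ → Set
Periodic s D = ∀ n → s (n + D) ≡ s n

xor≡false⇒≡ : ∀ x y → x xor y ≡ false → x ≡ y
xor≡false⇒≡ false false _ = refl
xor≡false⇒≡ true  true  _ = refl

module _ (P S : Poly) {D s} (s⁻¹ : IsInverse P s) (PS≈ : (P *ₚ S) ≈ₚ onePlusQPow D) where

  -- (1 + q^D) s = S P s = S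
  inverse-cofactor : ∀ n → s n xor conv (qPow D) s n ≡ coeff S n
  inverse-cofactor n = begin
    s n xor conv (qPow D) s n             ≡⟨ cong (_xor conv (qPow D) s n) (conv-oneₚ s n) ⟨
    conv oneₚ s n xor conv (qPow D) s n   ≡⟨ conv-+ₚ oneₚ (qPow D) s n ⟨
    conv (onePlusQPow D) s n              ≡⟨ conv-congˡ (onePlusQPow D) (S *ₚ P) s SP≈ n ⟩
    conv (S *ₚ P) s n                     ≡⟨ conv-*ₚ S P s n ⟩
    conv S (conv P s) n                   ≡⟨ conv-congʳ S s⁻¹ n ⟩
    conv S (coeff oneₚ) n                 ≡⟨ conv-coeff-oneₚ S n ⟩
    coeff S n                             ∎
    where
    open ≡-Reasoning
    SP≈ : onePlusQPow D ≈ₚ (S *ₚ P)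
    SP≈ k = trans (sym (PS≈ k)) (*ₚ-comm P S k)

  inverse-below : ∀ {n} → n < D → s n ≡ coeff S n
  inverse-below {n} n<D = begin
    s n                         ≡⟨ xor-identityʳ (s n) ⟨
    s n xor false               ≡⟨ cong (s n xor_) (conv-qPow-< D s n<D) ⟨
    s n xor conv (qPow D) s n   ≡⟨ inverse-cofactor n ⟩
    coeff S n                   ∎
    where open ≡-Reasoning

  inverse-periodic : (∀ {i} → D ≤ i → coeff S i ≡ false) → Periodic s D
  inverse-periodic S-vanishing n = xor≡false⇒≡ (s (n + D)) (s n) (begin
    s (n + D) xor s n                       ≡⟨ cong (s (n + D) xor_) (conv-qPow-+ D s n) ⟨
    s (n + D) xor conv (qPow D) s (n + D)   ≡⟨ inverse-cofactor (n + D) ⟩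
    coeff S (n + D)                         ≡⟨ S-vanishing (ℕ.m≤n+m D n) ⟩
    false                                   ∎)
    where open ≡-Reasoning

-- Densities of periodic sequences

countBelow : (ℕ → Bool) → ℕ → ℕ
countBelow s zero    = 0
countBelow s (suc n) = countBelow s n + (if s n then 1 else 0)

count≡countBelow : ∀ s n → count s n ≡ countBelow s (suc n)
count≡countBelow s zero    = refl
count≡countBelow s (suc n) = cong (_+ (if s (suc n) then 1 else 0)) (count≡countBelow s n)

countBelow-cong : ∀ {f g} n → (∀ {i} → i < n → f i ≡ g i) → countBelow f n ≡ countBelow g n
countBelow-cong zero    _   = refl
countBelow-cong (suc n) f≗g =
  cong₂ _+_ (countBelow-cong n (f≗g ∘ ℕ.m≤n⇒m≤1+n)) (cong (if_then 1 else 0) (f≗g ℕ.≤-refl))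

countBelow-≤ : ∀ f n → countBelow f n ≤ n
countBelow-≤ f zero    = z≤n
countBelow-≤ f (suc n) with f n
... | true  = ℕ.≤-trans (ℕ.+-monoˡ-≤ 1 (countBelow-≤ f n)) (ℕ.≤-reflexive (ℕ.+-comm n 1))
... | false = ℕ.≤-trans (ℕ.≤-reflexive (ℕ.+-identityʳ _)) (ℕ.m≤n⇒m≤1+n (countBelow-≤ f n))

countBelow-mono : ∀ f {m n} → m ≤ n → countBelow f m ≤ countBelow f n
countBelow-mono f {n = zero}  z≤n = ℕ.≤-refl
countBelow-mono f {n = suc n} m≤1+n with ℕ.m≤n⇒m<n∨m≡n m≤1+n
... | inj₁ (s≤s m≤n) = ℕ.≤-trans (countBelow-mono f m≤n) (ℕ.m≤m+n _ _)
... | inj₂ refl      = ℕ.≤-refl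

countBelow-vanishing : ∀ {f k} → (∀ {i} → k ≤ i → f i ≡ false) →
  ∀ {n} → k ≤ n → countBelow f n ≡ countBelow f k
countBelow-vanishing f-vanishing {zero}  z≤n   = refl
countBelow-vanishing {f} f-vanishing {suc n} k≤1+n with ℕ.m≤n⇒m<n∨m≡n k≤1+n
... | inj₁ (s≤s k≤n) = trans (cong (countBelow f n +_) (cong (if_then 1 else 0) (f-vanishing k≤n)))
                             (trans (ℕ.+-identityʳ _) (countBelow-vanishing f-vanishing k≤n))
... | inj₂ refl      = refl

countBelow-hasDegree : ∀ {f d} → HasDegree f d → ∀ {n} → d < n → countBelow f n ≤ suc d
countBelow-hasDegree {f} f↑ d<n =
  ℕ.≤-trans (ℕ.≤-reflexive (countBelow-vanishing (vanishing f↑) d<n)) (countBelow-≤ f _)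

countBelow-hasDegree-*2 : ∀ {f d n} → HasDegree f d → d < n → suc d * 2 ≤ n → countBelow f n * 2 ≤ n
countBelow-hasDegree-*2 f↑ d<n [1+d]*2≤n = ℕ.≤-trans (ℕ.*-monoˡ-≤ 2 (countBelow-hasDegree f↑ d<n)) [1+d]*2≤n

module _ {s D} (s-periodic : Periodic s D) where

  countBelow-period-+ : ∀ n → countBelow s (D + n) ≡ countBelow s D + countBelow s n
  countBelow-period-+ zero    = trans (cong (countBelow s) (ℕ.+-identityʳ D)) (sym (ℕ.+-identityʳ _))
  countBelow-period-+ (suc n) = begin
    countBelow s (D + suc n)
      ≡⟨ cong (countBelow s) (ℕ.+-suc D n) ⟩
    countBelow s (D + n) + (if s (D + n) then 1 else 0)
      ≡⟨ cong₂ _+_ (countBelow-period-+ n) (cong (if_then 1 else 0) s-shift) ⟩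
    countBelow s D + countBelow s n + (if s n then 1 else 0)
      ≡⟨ ℕ.+-assoc (countBelow s D) _ _ ⟩
    countBelow s D + countBelow s (suc n)
      ∎
    where
    open ≡-Reasoning
    s-shift : s (D + n) ≡ s n
    s-shift = trans (cong s (ℕ.+-comm D n)) (s-periodic n)

  countBelow-periods-+ : ∀ q r → countBelow s (q * D + r) ≡ q * countBelow s D + countBelow s r
  countBelow-periods-+ zero    r = refl
  countBelow-periods-+ (suc q) r = begin
    countBelow s (D + q * D + r)                             ≡⟨ cong (countBelow s) (ℕ.+-assoc D (q * D) r) ⟩
    countBelow s (D + (q * D + r))                           ≡⟨ countBelow-period-+ (q * D + r) ⟩
    countBelow s D + countBelow s (q * D + r)                ≡⟨ cong (countBelow s D +_) (countBelow-periods-+ q r) ⟩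
    countBelow s D + (q * countBelow s D + countBelow s r)   ≡⟨ ℕ.+-assoc (countBelow s D) _ _ ⟨
    countBelow s D + q * countBelow s D + countBelow s r     ∎
    where open ≡-Reasoning

  countBelow-deviation-periods : ∀ q r → r ≤ D →
    ℤ.∣ countBelow s (q * D + r) * D ⊖ countBelow s D * (q * D + r) ∣ ≤ countBelow s D * D
  countBelow-deviation-periods q r r≤D = begin
    ℤ.∣ countBelow s (q * D + r) * D ⊖ w * (q * D + r) ∣
      ≡⟨ cong ℤ.∣_∣ (cong₂ _⊖_ count-q*D+r (w*[q*D+r] w q D r)) ⟩
    ℤ.∣ (q * w * D + c * D) ⊖ (q * w * D + w * r) ∣
      ≡⟨ cong ℤ.∣_∣ (ℤP.+-cancelˡ-⊖ (q * w * D) _ _) ⟩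
    ℤ.∣ c * D ⊖ w * r ∣
      ≤⟨ ℤP.∣m⊝n∣≤m⊔n (c * D) (w * r) ⟩
    c * D ⊔ w * r
      ≤⟨ ℕ.⊔-lub (ℕ.*-monoˡ-≤ D (countBelow-mono s r≤D)) (ℕ.*-monoʳ-≤ w r≤D) ⟩
    w * D
      ∎
    where
    open ℕ.≤-Reasoning
    w = countBelow s D
    c = countBelow s r
    count-q*D+r : countBelow s (q * D + r) * D ≡ q * w * D + c * D
    count-q*D+r = trans (cong (_* D) (countBelow-periods-+ q r)) (ℕ.*-distribʳ-+ D (q * w) c)
    w*[q*D+r] : ∀ w q D r → w * (q * D + r) ≡ q * w * D + w * r
    w*[q*D+r] = solve-∀

  countBelow-deviation : .{{_ : NonZero D}} → ∀ N →
    ℤ.∣ countBelow s N * D ⊖ countBelow s D * N ∣ ≤ countBelow s D * D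
  countBelow-deviation N = subst (λ N → ℤ.∣ countBelow s N * D ⊖ countBelow s D * N ∣ ≤ countBelow s D * D)
    (sym N≡q*D+r) (countBelow-deviation-periods (N ℕ./ D) (N ℕ.% D) (ℕ.<⇒≤ (ℕ.m%n<n N D)))
    where
    N≡q*D+r : N ≡ N ℕ./ D * D + N ℕ.% D
    N≡q*D+r = trans (ℕ.m≡m%n+[m/n]*n N D) (ℕ.+-comm (N ℕ.% D) _)

fraction-distance-≤ : ∀ c n w D′ {p den} .(cop : Coprime (suc p) (suc den)) →
  ℤ.∣ c * suc D′ ⊖ w * suc n ∣ * suc den ≤ suc p * (suc n * suc D′) →
  ∣ ℤ.+ c / suc n - ℤ.+ w / suc D′ ∣ ℚ.≤ mkℚ ℤ.+[1+ p ] den cop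
fraction-distance-≤ c n w D′ {p} {den} cop bound =
  ℚP.toℚᵘ-cancel-≤ (ℚᵘP.≤-respˡ-≃ (ℚᵘP.≃-sym distance≃) (*≤* scaled-bound))
  where
  X = mkℚᵘ (ℤ.+ c) n
  W = mkℚᵘ (ℤ.+ w) D′
  distance≃ : toℚᵘ ∣ fromℚᵘ X - fromℚᵘ W ∣ ℚᵘ.≃ ℚᵘ.∣ X ℚᵘ.- W ∣
  distance≃ = ℚᵘP.≃-trans (ℚP.toℚᵘ-homo-∣-∣ (fromℚᵘ X - fromℚᵘ W)) (ℚᵘP.∣-∣-cong
    (ℚᵘP.≃-trans (ℚP.toℚᵘ-homo-+ (fromℚᵘ X) (ℚ.- fromℚᵘ W))
    (ℚᵘP.+-cong (ℚP.toℚᵘ-fromℚᵘ X)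
                (ℚᵘP.≃-trans (ℚP.toℚᵘ-homo‿- (fromℚᵘ W)) (ℚᵘP.-‿cong (ℚP.toℚᵘ-fromℚᵘ W))))))
  numerator : ℤ.+ c ℤ.* ℤ.+ suc D′ ℤ.+ (ℤ.- ℤ.+ w) ℤ.* ℤ.+ suc n ≡ c * suc D′ ⊖ w * suc n
  numerator = begin
    ℤ.+ c ℤ.* ℤ.+ suc D′ ℤ.+ (ℤ.- ℤ.+ w) ℤ.* ℤ.+ suc n
      ≡⟨ cong₂ ℤ._+_ (ℤP.pos-* c (suc D′)) (ℤP.neg-distribˡ-* (ℤ.+ w) (ℤ.+ suc n)) ⟨
    ℤ.+ (c * suc D′) ℤ.+ ℤ.- (ℤ.+ w ℤ.* ℤ.+ suc n)
      ≡⟨ cong (λ z → ℤ.+ (c * suc D′) ℤ.+ ℤ.- z) (ℤP.pos-* w (suc n)) ⟨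
    ℤ.+ (c * suc D′) ℤ.+ ℤ.- ℤ.+ (w * suc n)
      ≡⟨ ℤP.m-n≡m⊖n (c * suc D′) (w * suc n) ⟩
    c * suc D′ ⊖ w * suc n
      ∎
    where open ≡-Reasoning
  scaled-bound : ℤ.+ ℤ.∣ ℤ.+ c ℤ.* ℤ.+ suc D′ ℤ.+ (ℤ.- ℤ.+ w) ℤ.* ℤ.+ suc n ∣ ℤ.* ℤ.+ suc den
                   ℤ.≤ ℤ.+[1+ p ] ℤ.* ℤ.+ (suc n * suc D′)
  scaled-bound rewrite numerator =
    subst₂ ℤ._≤_ (ℤP.pos-* ℤ.∣ c * suc D′ ⊖ w * suc n ∣ (suc den)) (ℤP.pos-* (suc p) (suc n * suc D′))
           (ℤ.+≤+ bound)

fraction-≤-½ : ∀ w D′ → w * 2 ≤ suc D′ → ℤ.+ w / suc D′ ℚ.≤ ½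
fraction-≤-½ w D′ w*2≤D =
  ℚP.toℚᵘ-cancel-≤ (ℚᵘP.≤-respˡ-≃ (ℚᵘP.≃-sym (ℚP.toℚᵘ-fromℚᵘ (mkℚᵘ (ℤ.+ w) D′)))
    (*≤* (subst₂ ℤ._≤_ (ℤP.pos-* w 2) (sym (ℤP.*-identityˡ (ℤ.+ suc D′))) (ℤ.+≤+ w*2≤D))))

periodic-hasDensityAtMost-½ : ∀ {s D′} → Periodic s (suc D′) → countBelow s (suc D′) * 2 ≤ suc D′ →
  HasDensityAtMost s ½
periodic-hasDensityAtMost-½ {s} {D′} s-periodic w*2≤D = ℤ.+ w / D , fraction-≤-½ w D′ w*2≤D , converges
  where
  D = suc D′
  w = countBelow s D
  w≤D : w ≤ D
  w≤D = ℕ.≤-trans (ℕ.m≤m*n w 2) w*2≤D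
  scaled-deviation : ∀ {p den} n → D * suc den ≤ suc n →
    ℤ.∣ countBelow s (suc n) * D ⊖ w * suc n ∣ * suc den ≤ suc p * (suc n * D)
  scaled-deviation {p} {den} n D*[1+den]≤N = begin
    ℤ.∣ countBelow s (suc n) * D ⊖ w * suc n ∣ * suc den
      ≤⟨ ℕ.*-monoˡ-≤ (suc den) (countBelow-deviation s-periodic (suc n)) ⟩
    w * D * suc den   ≤⟨ ℕ.*-monoˡ-≤ (suc den) (ℕ.*-monoˡ-≤ D w≤D) ⟩
    D * D * suc den   ≡⟨ ℕ.*-assoc D D (suc den) ⟩
    D * (D * suc den) ≤⟨ ℕ.*-monoʳ-≤ D D*[1+den]≤N ⟩
    D * suc n         ≡⟨ ℕ.*-comm D (suc n) ⟩
    suc n * D         ≤⟨ ℕ.m≤n*m (suc n * D) (suc p) ⟩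
    suc p * (suc n * D) ∎
    where open ℕ.≤-Reasoning
  -- |count/N - w/D| ≤ w D/(N D) ≤ D/N ≤ 1/(1 + den) ≤ ε as soon as N ≥ D (1 + den)
  converges : ∀ ε → ℚ.0ℚ ℚ.< ε →
    Σ ℕ λ N → ∀ n → N ≤ n → ∣ ℤ.+ count s n / suc n - ℤ.+ w / D ∣ ℚ.≤ ε
  converges (mkℚ ℤ.+[1+ p ] den cop) _ = D * suc den , λ n N≤n →
    subst (λ c → ∣ ℤ.+ c / suc n - ℤ.+ w / D ∣ ℚ.≤ mkℚ ℤ.+[1+ p ] den cop) (sym (count≡countBelow s n))
      (fraction-distance-≤ (countBelow s (suc n)) n w D′ cop (scaled-deviation {p} n (ℕ.m≤n⇒m≤1+n N≤n)))
  converges (mkℚ (ℤ.+ 0)    _ _) (ℚ.*<* (ℤ.+<+ ()))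
  converges (mkℚ ℤ.-[1+ _ ] _ _) (ℚ.*<* ())

-- The weight of P*

ord-≤ : ∀ Q {N} → IsOrd Q N → ∀ m → 0 < m → Q ∣ₚ onePlusQPow m → N ≤ m
ord-≤ Q (_ , _ , minimal) m 0<m Q∣ = ℕ.≮⇒≥ (λ m<N → minimal m 0<m m<N Q∣)

middle-of-1+q³/[1+q] : ∀ x →
  coeff (true ∷ x ∷ true ∷ []) ⊛ coeff (true ∷ true ∷ []) ≗ coeff (onePlusQPow 3) → x ≡ true
middle-of-1+q³/[1+q] true  _ = refl
middle-of-1+q³/[1+q] false h = case h 1 of λ ()

1+q+q²-∤-1+q⁴ : ∀ x →
  ¬ (coeff (true ∷ x ∷ true ∷ []) ⊛ coeff (true ∷ true ∷ true ∷ []) ≗ coeff (onePlusQPow 4))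
1+q+q²-∤-1+q⁴ false h = case h 1 of λ ()
1+q+q²-∤-1+q⁴ true  h = case h 2 of λ ()

1+q+q²-∤-1+q⁵ : ∀ x y →
  ¬ (coeff (true ∷ x ∷ y ∷ true ∷ []) ⊛ coeff (true ∷ true ∷ true ∷ []) ≗ coeff (onePlusQPow 5))
1+q+q²-∤-1+q⁵ false y     h = case h 1 of λ ()
1+q+q²-∤-1+q⁵ true  true  h = case h 2 of λ ()
1+q+q²-∤-1+q⁵ true  false h = case h 4 of λ ()

ord-3⇒middle≡true : ∀ S {y} → S ≈ₚ (true ∷ y ∷ true ∷ []) → IsOrd S 3 → y ≡ true
ord-3⇒middle≡true S {true}  _  _     = refl
ord-3⇒middle≡true S {false} S≈ S-ord = case ord-≤ S S-ord 2 (s≤s z≤n) S∣1+q² of λ { (s≤s (s≤s ())) }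
  where
  S∣1+q² : S ∣ₚ onePlusQPow 2
  S∣1+q² = oneₚ , *ₚ-congˡ S (true ∷ false ∷ true ∷ []) oneₚ S≈

ord-7⇒¬middle≡true : ∀ S {y z} → S ≈ₚ (true ∷ y ∷ z ∷ true ∷ []) → IsOrd S 7 →
  y ≡ true → z ≡ true → ⊥
ord-7⇒¬middle≡true S S≈ S-ord refl refl =
  case ord-≤ S S-ord 4 (s≤s z≤n) S∣1+q⁴ of λ { (s≤s (s≤s (s≤s (s≤s ())))) }
  where
  S∣1+q⁴ : S ∣ₚ onePlusQPow 4
  S∣1+q⁴ = (true ∷ true ∷ []) , *ₚ-congˡ S (true ∷ true ∷ true ∷ true ∷ []) (true ∷ true ∷ []) S≈

countBelow-1+yq+zq²+q³ : ∀ y z → (y ≡ true → z ≡ true → ⊥) →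
  countBelow (coeff (true ∷ y ∷ z ∷ true ∷ [])) 4 ≤ 3
countBelow-1+yq+zq²+q³ true  true  ¬y∧z = ⊥-elim (¬y∧z refl refl)
countBelow-1+yq+zq²+q³ true  false _    = ℕ.≤-refl
countBelow-1+yq+zq²+q³ false true  _    = ℕ.≤-refl
countBelow-1+yq+zq²+q³ false false _    = ℕ.n≤1+n 2

ord-7⇒countBelow≤3 : ∀ S → coeff S 0 ≡ true → HasDegree (coeff S) 3 → IsOrd S 7 → ∀ {D} → 3 < D →
  countBelow (coeff S) D ≤ 3
ord-7⇒countBelow≤3 S S₀ S↑ S-ord {D} 3<D = begin
  countBelow (coeff S) D
    ≡⟨ countBelow-vanishing (vanishing S↑) 3<D ⟩
  countBelow (coeff S) 4
    ≡⟨ countBelow-cong 4 (λ {i} _ → S≈ i) ⟩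
  countBelow (coeff (true ∷ coeff S 1 ∷ coeff S 2 ∷ true ∷ [])) 4
    ≤⟨ countBelow-1+yq+zq²+q³ _ _ (ord-7⇒¬middle≡true S S≈ S-ord) ⟩
  3
    ∎
  where
  open ℕ.≤-Reasoning
  S≈ : S ≈ₚ (true ∷ coeff S 1 ∷ coeff S 2 ∷ true ∷ [])
  S≈ = ≈ₚ-explicit S 2 S₀ S↑

[5+b]*2<2^[4+b] : ∀ b → suc (4 + b) * 2 < 2 ^ (4 + b)
[5+b]*2<2^[4+b] zero    = ℕ.m≤m+n 11 5
[5+b]*2<2^[4+b] (suc b) = begin-strict
  2 + suc (4 + b) * 2         <⟨ ℕ.+-monoʳ-< 2 ([5+b]*2<2^[4+b] b) ⟩
  2 + 2 ^ (4 + b)             ≤⟨ ℕ.+-monoˡ-≤ (2 ^ (4 + b)) (ℕ.^-monoʳ-≤ 2 {1} {4 + b} (s≤s z≤n)) ⟩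
  2 ^ (4 + b) + 2 ^ (4 + b)   ≡⟨ cong (2 ^ (4 + b) +_) (ℕ.+-identityʳ (2 ^ (4 + b))) ⟨
  2 ^ (5 + b)                 ∎
  where open ℕ.≤-Reasoning

module _ (P S : Poly) (P₀ : coeff P 0 ≡ true) (S₀ : coeff S 0 ≡ true) where

  ord-≤-cofactor : ∀ {N D} → IsOrd S N → 0 < D → coeff P ⊛ coeff S ≗ coeff (onePlusQPow D) → N ≤ D
  ord-≤-cofactor {D = D} S-ord 0<D PS≗ = ord-≤ S S-ord D 0<D
    (P , λ n → trans (coeff-*ₚ S P n) (trans (⊛-comm (coeff S) (coeff P) n) (PS≗ n)))

  ord-3⇒≈1+q+q² : HasDegree (coeff S) 2 → IsOrd S 3 → S ≈ₚ (true ∷ true ∷ true ∷ [])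
  ord-3⇒≈1+q+q² S↑ S-ord = subst (λ y → S ≈ₚ (true ∷ y ∷ true ∷ [])) (ord-3⇒middle≡true S S≈ S-ord) S≈
    where
    S≈ : S ≈ₚ (true ∷ coeff S 1 ∷ true ∷ [])
    S≈ = ≈ₚ-explicit S 1 S₀ S↑

  cofactor-weight-bound : ∀ a b {D} → 2 ≤ a → a + b ≡ D →
    HasDegree (coeff P) a → HasDegree (coeff S) b → coeff P ⊛ coeff S ≗ coeff (onePlusQPow D) →
    ¬ (P ≈ₚ (true ∷ true ∷ true ∷ [])) → IsOrd S (2 ^ b ∸ 1) →
    countBelow (coeff S) D * 2 ≤ D
  cofactor-weight-bound 1 _ (s≤s ()) _ _ _ _ _ _
  cofactor-weight-bound a 0 _ _ _ _ _ _ (() , _)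
  cofactor-weight-bound 2 1 _ refl P↑ S↑ PS≗ P≉1+q+q² _ =
    ⊥-elim (P≉1+q+q² (subst (λ x → P ≈ₚ (true ∷ x ∷ true ∷ [])) x≡true P≈))
    where
    P≈ : P ≈ₚ (true ∷ coeff P 1 ∷ true ∷ [])
    P≈ = ≈ₚ-explicit P 1 P₀ P↑
    x≡true : coeff P 1 ≡ true
    x≡true = middle-of-1+q³/[1+q] (coeff P 1) (⊛-resp-≗ P≈ (≈ₚ-explicit S 0 S₀ S↑) PS≗)
  cofactor-weight-bound (suc (suc (suc a))) 1 _ refl _ S↑ _ _ _ =
    countBelow-hasDegree-*2 S↑ (ℕ.m<n+m 1 {3 + a} (s≤s z≤n)) (ℕ.+-monoʳ-≤ 3 (ℕ.m≤n+m 1 a))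
  cofactor-weight-bound 2 2 _ refl P↑ S↑ PS≗ _ S-ord =
    ⊥-elim (1+q+q²-∤-1+q⁴ (coeff P 1) (⊛-resp-≗ (≈ₚ-explicit P 1 P₀ P↑) (ord-3⇒≈1+q+q² S↑ S-ord) PS≗))
  cofactor-weight-bound 3 2 _ refl P↑ S↑ PS≗ _ S-ord =
    ⊥-elim (1+q+q²-∤-1+q⁵ (coeff P 1) (coeff P 2)
      (⊛-resp-≗ (≈ₚ-explicit P 2 P₀ P↑) (ord-3⇒≈1+q+q² S↑ S-ord) PS≗))
  cofactor-weight-bound (suc (suc (suc (suc a)))) 2 _ refl _ S↑ _ _ _ =
    countBelow-hasDegree-*2 S↑ (ℕ.m<n+m 2 {4 + a} (s≤s z≤n)) (ℕ.+-monoʳ-≤ 4 (ℕ.m≤n+m 2 a))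
  cofactor-weight-bound (suc (suc a)) 3 _ refl _ S↑ PS≗ _ S-ord =
    ℕ.≤-trans (ℕ.*-monoˡ-≤ 2 (ord-7⇒countBelow≤3 S S₀ S↑ S-ord (ℕ.m<n+m 3 {2 + a} (s≤s z≤n))))
              (ℕ.≤-trans (ℕ.n≤1+n 6) (ord-≤-cofactor S-ord (s≤s z≤n) PS≗))
  cofactor-weight-bound (suc (suc a)) b@(suc (suc (suc (suc b′)))) _ refl _ S↑ PS≗ _ S-ord =
    countBelow-hasDegree-*2 S↑ (ℕ.m<n+m b {2 + a} (s≤s z≤n))
      (ℕ.≤-trans (ℕ.∸-monoˡ-≤ 1 ([5+b]*2<2^[4+b] b′)) (ord-≤-cofactor S-ord (s≤s z≤n) PS≗))

corollary4p6 : (P : Poly) → coeff P 0 ≡ true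
    → ¬ (P ≈ₚ (true ∷ []))
    → ¬ (P ≈ₚ (true ∷ true ∷ []))
    → ¬ (P ≈ₚ (true ∷ true ∷ true ∷ []))
    → (D : ℕ) → IsOrd P D
    → (Pstar : Poly) → (P *ₚ Pstar) ≈ₚ onePlusQPow D
    → Primitive Pstar
    → (s : ℕ → Bool) → IsInverse P s
    → HasDensityAtMost s ½
corollary4p6 P P₀ P≉1 P≉1+q P≉1+q+q² zero (() , _) _ _ _ _ _
corollary4p6 P P₀ P≉1 P≉1+q P≉1+q+q² D@(suc _) _ S PS≈ S-primitive s s⁻¹ =
  periodic-hasDensityAtMost-½ s-periodic (subst (λ w → w * 2 ≤ D) (sym weight≡) weight-bound)
  where
  PS≗ : coeff P ⊛ coeff S ≗ coeff (onePlusQPow D)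
  PS≗ n = trans (sym (coeff-*ₚ P S n)) (PS≈ n)
  S₀ : coeff S 0 ≡ true
  S₀ = trans (cong (_∧ coeff S 0) (sym P₀)) (PS≗ 0)
  P↑ = deg-hasDegree P P₀
  S↑ = deg-hasDegree S S₀
  degree-sum : deg P + deg S ≡ D
  degree-sum = hasDegree-unique (hasDegree-cong PS≗ (⊛-hasDegree (deg P) P↑ S↑)) (onePlusQPow-hasDegree D (s≤s z≤n))
  2≤deg-P : 2 ≤ deg P
  2≤deg-P = 2≤degree P P₀ P↑ P≉1 P≉1+q
  deg-S<D : deg S < D
  deg-S<D = subst (deg S <_) degree-sum (ℕ.m<n+m (deg S) (ℕ.<-≤-trans (s≤s z≤n) 2≤deg-P))
  s-periodic : Periodic s D
  s-periodic = inverse-periodic P S s⁻¹ PS≈ (λ D≤i → vanishing S↑ (ℕ.<-≤-trans deg-S<D D≤i))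
  weight≡ : countBelow s D ≡ countBelow (coeff S) D
  weight≡ = countBelow-cong D (inverse-below P S s⁻¹ PS≈)
  weight-bound : countBelow (coeff S) D * 2 ≤ D
  weight-bound = cofactor-weight-bound P S P₀ S₀ (deg P) (deg S) 2≤deg-P degree-sum P↑ S↑ PS≗ P≉1+q+q² S-primitive
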